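{- Let $G \cong C_2^3$ (an elementary abelian group of order $8$). Let $S$ be a squarefree sequence of length $5$ over $G$, i.e. $S = g_1 g_2 g_3 g_4 g_5$ with $g_1,\dots,g_5 \in G$ pairwise distinct. Then $S$ has exactly one subsequence $T$ of length $|T| = 4$ with $\sigma(T) = 0$.
   Context: A sequence over a finite abelian group $G$ is an element of the free abelian monoid over $G$ (a finite unordered list of elements of $G$ with repetition allowed), written multiplicatively as $S = g_1\cdots g_\ell$. Its length is $|S|=\ell$ and its sum is $\sigma(S)=g_1+\dots+g_\ell$. A subsequence is a divisor in this free monoid (a sub-multiset). $S$ is squarefree if each element of $G$ occurs at most once in $S$. Subsequences are counted as sub-multisets (so for a squarefree sequence, as subsets). -}

module Defs where

open import Data.Bool using (Bool; true; false; _xor_)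
open import Data.Nat using (ℕ)
open import Data.Fin using (Fin)
open import Data.Vec using (Vec; zipWith; replicate; lookup; foldr; tabulate)
open import Data.Fin.Subset using (Subset; inside; outside; _∈_)
open import Data.List using (List; filter; allFin) renaming (foldr to lfoldr)
open import Data.Fin.Subset.Properties using (_∈?_)
open import Relation.Binary.PropositionalEquality using (_≡_)

C₂³ : Set
C₂³ = Vec Bool 3

infixl 6 _⊕_
_⊕_ : C₂³ → C₂³ → C₂³
_⊕_ = zipWith _xor_

𝟘 : C₂³
𝟘 = replicate 3 false

Squarefree : ∀ {n} → Vec C₂³ n → Set
Squarefree {n} S = ∀ (i j : Fin n) → lookup S i ≡ lookup S j → i ≡ j

-- σ of the subsequence of S selected by the index set T:
-- the sum of the terms S i with i ∈ T.
σ : ∀ {n} → Vec C₂³ n → Subset n → C₂³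
σ {n} S T = lfoldr (λ i acc → lookup S i ⊕ acc) 𝟘 (filter (_∈? T) (allFin n))

module Submission where

-- A 4-element subset of the index set Fin 5 is the complement of a
-- singleton {i}, and its sum is σ(S) ⊕ gᵢ; as every element is its own
-- inverse, this vanishes exactly when gᵢ = σ(S).  Since the gᵢ are
-- distinct, at most one index qualifies, which gives uniqueness.
--
-- Existence is the statement that σ(S) is one of the gᵢ.  The eight
-- elements of C₂³ sum to 𝟘, so σ(S) equals the sum h₁ ⊕ h₂ ⊕ h₃ of the
-- three elements missing from S.  That sum differs from each hⱼ (e.g.
-- h₁ ⊕ h₂ ⊕ h₃ = h₁ would force h₂ = h₃), hence it lies in S.

open import Defs
open import Algebra.Bundles using (AbelianGroup)
open import Algebra.Structures using (IsAbelianGroup)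
import Algebra.Properties.AbelianGroup as AbelianGroupProperties
import Algebra.Properties.CommutativeSemigroup as CommutativeSemigroupProperties
open import Data.Bool using (Bool; true; false; not; _xor_)
open import Data.Bool.Properties using (xor-assoc; xor-comm; xor-identityˡ; xor-identityʳ; xor-same)
import Data.Bool.Properties as Bool
open import Data.Empty using (⊥-elim)
open import Data.Fin using (Fin; zero; suc)
open import Data.Fin.Subset using (Subset; inside; outside; ⊤; ⊥; ⁅_⁆; ∁; ∣_∣)
open import Data.Fin.Subset.Properties using (_∈?_; ∣p∣≡n⇒p≡⊤; ∣∁p∣≡n∸∣p∣; ∣⁅x⁆∣≡1)
open import Data.List using (List; []; _∷_; _++_; filter; allFin; length; tabulate; map) renaming (foldr to lfoldr)
open import Data.List.Membership.Propositional using (_∈_; _∉_)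
open import Data.List.Membership.Propositional.Properties using (∈-++⁺ˡ; ∈-++⁺ʳ; ∈-++⁻; ∈-filter⁺; ∈-filter⁻; ∈-tabulate⁻)
open import Data.List.Membership.Propositional.Properties.WithK using (unique∧set⇒bag)
open import Data.List.Properties using (map-tabulate; length-++; length-tabulate)
open import Data.List.Relation.Binary.BagAndSetEquality using (∼bag⇒↭)
open import Data.List.Relation.Binary.Disjoint.Propositional using (Disjoint)
open import Data.List.Relation.Binary.Permutation.Propositional using (_↭_; ↭⇒↭ₛ)
open import Data.List.Relation.Binary.Permutation.Propositional.Properties using (∈-resp-↭; ↭-length)
open import Data.List.Relation.Binary.Permutation.Setoid.Properties using (foldr-commMonoid)
open import Data.List.Relation.Unary.Any using (here; there)
open import Data.List.Relation.Unary.AllPairs using ([]; _∷_)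
open import Data.List.Relation.Unary.All using ([]; _∷_)
open import Data.List.Relation.Unary.Unique.Propositional using (Unique)
import Data.List.Relation.Unary.Unique.Propositional.Properties as Unique
import Data.List.Membership.DecPropositional as DecMembership
import Data.List.Relation.Unary.Unique.DecPropositional as DecUnique
open import Data.Nat using (ℕ; suc; _+_; _∸_)
open import Data.Nat.Properties using (+-cancelˡ-≡; suc-injective)
open import Data.Product using (∃; _×_; _,_; proj₂)
open import Data.Sum using (inj₁; inj₂)
open import Data.Vec using (Vec; []; _∷_; lookup; zipWith; replicate)
open import Data.Vec.Properties using (zipWith-assoc; zipWith-comm; zipWith-identityˡ; zipWith-identityʳ; map-replicate; ≡-dec)
open import Function using (id; _∘_; mk⇔; _⇔_; Equivalence)
open import Relation.Binary.PropositionalEquality using (_≡_; refl; sym; trans; cong; cong₂; subst; isEquivalence; setoid; module ≡-Reasoning)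
open import Relation.Nullary using (yes; no; ¬?)
open import Relation.Nullary.Decidable using (toWitness)
open import Relation.Binary.Definitions using (DecidableEquality)
open import Relation.Unary using (Decidable)

private
  variable
    n : ℕ

xor-self : ∀ {m} (x : Vec Bool m) → zipWith _xor_ x x ≡ replicate m false
xor-self []       = refl
xor-self (b ∷ x) = cong₂ _∷_ (xor-same b) (xor-self x)

⊕-isAbelianGroup : IsAbelianGroup _≡_ _⊕_ 𝟘 id
⊕-isAbelianGroup = record
  { isGroup = record
    { isMonoid = record
      { isSemigroup = record
        { isMagma = record { isEquivalence = isEquivalence ; ∙-cong = cong₂ _⊕_ }
        ; assoc   = zipWith-assoc xor-assoc
        }
      ; identity = zipWith-identityˡ xor-identityˡ , zipWith-identityʳ xor-identityʳ
      }
    ; inverse = xor-self , xor-self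
    ; ⁻¹-cong = cong id
    }
  ; comm = zipWith-comm xor-comm
  }

⊕-abelianGroup : AbelianGroup _ _
⊕-abelianGroup = record { isAbelianGroup = ⊕-isAbelianGroup }

open AbelianGroup ⊕-abelianGroup using (assoc; comm; identityˡ; identityʳ; isCommutativeMonoid; commutativeSemigroup)
open AbelianGroupProperties ⊕-abelianGroup using (identityˡ-unique; identityʳ-unique; inverseˡ-unique)
open CommutativeSemigroupProperties commutativeSemigroup using (x∙yz≈y∙xz)

Σ : List C₂³ → C₂³
Σ = lfoldr _⊕_ 𝟘

Σ-++ : ∀ xs ys → Σ (xs ++ ys) ≡ Σ xs ⊕ Σ ys
Σ-++ []       ys = sym (identityˡ (Σ ys))
Σ-++ (x ∷ xs) ys = trans (cong (x ⊕_) (Σ-++ xs ys)) (sym (assoc x (Σ xs) (Σ ys)))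

Σ-↭ : ∀ {xs ys} → xs ↭ ys → Σ xs ≡ Σ ys
Σ-↭ p = foldr-commMonoid (setoid C₂³) isCommutativeMonoid (↭⇒↭ₛ p)

Σ-at : Vec C₂³ n → List (Fin n) → C₂³
Σ-at S = lfoldr (λ i acc → lookup S i ⊕ acc) 𝟘

allFin-suc : ∀ n → allFin (suc n) ≡ zero ∷ map suc (allFin n)
allFin-suc n = cong (zero ∷_) (sym (map-tabulate id suc))

Σ-at-shift : ∀ x (S : Vec C₂³ n) b T (is : List (Fin n)) →
  Σ-at (x ∷ S) (filter (_∈? (b ∷ T)) (map suc is)) ≡ Σ-at S (filter (_∈? T) is)
Σ-at-shift x S b T []       = refl
Σ-at-shift x S b T (i ∷ is) with i ∈? T
... | yes _ = cong (lookup S i ⊕_) (Σ-at-shift x S b T is)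
... | no _  = Σ-at-shift x S b T is

σ-tail : ∀ x (S : Vec C₂³ n) b T →
  Σ-at (x ∷ S) (filter (_∈? (b ∷ T)) (allFin (suc n))) ≡ Σ-at (x ∷ S) (filter (_∈? (b ∷ T)) (zero ∷ map suc (allFin n)))
σ-tail {n} x S b T = cong (Σ-at (x ∷ S) ∘ filter (_∈? (b ∷ T))) (allFin-suc n)

σ-inside : ∀ x (S : Vec C₂³ n) T → σ (x ∷ S) (inside ∷ T) ≡ x ⊕ σ S T
σ-inside {n} x S T = trans (σ-tail x S inside T) (cong (x ⊕_) (Σ-at-shift x S inside T (allFin n)))

σ-outside : ∀ x (S : Vec C₂³ n) T → σ (x ∷ S) (outside ∷ T) ≡ σ S T
σ-outside {n} x S T = trans (σ-tail x S outside T) (Σ-at-shift x S outside T (allFin n))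

terms : Vec C₂³ n → List C₂³
terms S = tabulate (lookup S)

σ-⊤ : (S : Vec C₂³ n) → σ S ⊤ ≡ Σ (terms S)
σ-⊤ []      = refl
σ-⊤ (x ∷ S) = trans (σ-inside x S ⊤) (cong (x ⊕_) (σ-⊤ S))

∁⊥≡⊤ : ∁ ⊥ ≡ ⊤ {n}
∁⊥≡⊤ {n} = map-replicate not outside n

σ-drop : (S : Vec C₂³ n) (i : Fin n) → σ S (∁ ⁅ i ⁆) ⊕ lookup S i ≡ σ S ⊤
σ-drop (x ∷ S) zero = begin
  σ (x ∷ S) (outside ∷ ∁ ⊥) ⊕ x  ≡⟨ cong (_⊕ x) (trans (σ-outside x S (∁ ⊥)) (cong (σ S) ∁⊥≡⊤)) ⟩
  σ S ⊤ ⊕ x                      ≡⟨ comm (σ S ⊤) x ⟩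
  x ⊕ σ S ⊤                      ≡⟨ sym (σ-inside x S ⊤) ⟩
  σ (x ∷ S) ⊤                    ∎
  where open ≡-Reasoning
σ-drop (x ∷ S) (suc i) = begin
  σ (x ∷ S) (inside ∷ ∁ ⁅ i ⁆) ⊕ lookup S i  ≡⟨ cong (_⊕ lookup S i) (σ-inside x S (∁ ⁅ i ⁆)) ⟩
  x ⊕ σ S (∁ ⁅ i ⁆) ⊕ lookup S i            ≡⟨ assoc x _ _ ⟩
  x ⊕ (σ S (∁ ⁅ i ⁆) ⊕ lookup S i)          ≡⟨ cong (x ⊕_) (σ-drop S i) ⟩
  x ⊕ σ S ⊤                                 ≡⟨ sym (σ-inside x S ⊤) ⟩
  σ (x ∷ S) ⊤                               ∎
  where open ≡-Reasoning

σ-drop-zero⇔ : (S : Vec C₂³ n) (i : Fin n) → σ S (∁ ⁅ i ⁆) ≡ 𝟘 ⇔ lookup S i ≡ σ S ⊤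
σ-drop-zero⇔ S i = mk⇔ to from
  where
    open ≡-Reasoning
    to : σ S (∁ ⁅ i ⁆) ≡ 𝟘 → lookup S i ≡ σ S ⊤
    to zero-sum = begin
      lookup S i                     ≡⟨ sym (identityˡ (lookup S i)) ⟩
      𝟘 ⊕ lookup S i                 ≡⟨ cong (_⊕ lookup S i) (sym zero-sum) ⟩
      σ S (∁ ⁅ i ⁆) ⊕ lookup S i     ≡⟨ σ-drop S i ⟩
      σ S ⊤                          ∎
    from : lookup S i ≡ σ S ⊤ → σ S (∁ ⁅ i ⁆) ≡ 𝟘
    from gᵢ≡σ = identityˡ-unique _ (lookup S i) (trans (σ-drop S i) (sym gᵢ≡σ))

∣p∣≡n⇒p≡∁⁅i⁆ : (p : Subset (suc n)) → ∣ p ∣ ≡ n → ∃ λ i → p ≡ ∁ ⁅ i ⁆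
∣p∣≡n⇒p≡∁⁅i⁆ (outside ∷ p) ∣p∣≡n = zero , cong (outside ∷_) (trans (∣p∣≡n⇒p≡⊤ ∣p∣≡n) (sym ∁⊥≡⊤))
∣p∣≡n⇒p≡∁⁅i⁆ {0}     (inside ∷ []) ()
∣p∣≡n⇒p≡∁⁅i⁆ {suc n} (inside ∷ p) ∣p∣≡n =
  let i , p≡∁⁅i⁆ = ∣p∣≡n⇒p≡∁⁅i⁆ p (suc-injective ∣p∣≡n) in suc i , cong (inside ∷_) p≡∁⁅i⁆

∣∁⁅i⁆∣ : (i : Fin n) → ∣ ∁ ⁅ i ⁆ ∣ ≡ n ∸ 1
∣∁⁅i⁆∣ {n} i = trans (∣∁p∣≡n∸∣p∣ ⁅ i ⁆) (cong (n ∸_) (∣⁅x⁆∣≡1 i))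

_≟_ : DecidableEquality C₂³
_≟_ = ≡-dec Bool._≟_

open DecMembership _≟_ using () renaming (_∈?_ to _∈ₗ?_)

elements : List C₂³
elements =
  (false ∷ false ∷ false ∷ []) ∷ (false ∷ false ∷ true ∷ []) ∷
  (false ∷ true  ∷ false ∷ []) ∷ (false ∷ true  ∷ true ∷ []) ∷
  (true  ∷ false ∷ false ∷ []) ∷ (true  ∷ false ∷ true ∷ []) ∷
  (true  ∷ true  ∷ false ∷ []) ∷ (true  ∷ true  ∷ true ∷ []) ∷ []

elements-complete : ∀ x → x ∈ elements
elements-complete (false ∷ false ∷ false ∷ []) = here refl
elements-complete (false ∷ false ∷ true  ∷ []) = there (here refl)
elements-complete (false ∷ true  ∷ false ∷ []) = there (there (here refl))
elements-complete (false ∷ true  ∷ true  ∷ []) = there (there (there (here refl)))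
elements-complete (true  ∷ false ∷ false ∷ []) = there (there (there (there (here refl))))
elements-complete (true  ∷ false ∷ true  ∷ []) = there (there (there (there (there (here refl)))))
elements-complete (true  ∷ true  ∷ false ∷ []) = there (there (there (there (there (there (here refl))))))
elements-complete (true  ∷ true  ∷ true  ∷ []) = there (there (there (there (there (there (there (here refl)))))))

elements-unique : Unique elements
elements-unique = toWitness {a? = DecUnique.unique? _≟_ elements} _

Σ-elements : Σ elements ≡ 𝟘
Σ-elements = refl

-- If x ⊕ (y ⊕ z) = x then y = z, as every element is its own inverse.
absorbed⇒equal : ∀ x y z → x ⊕ (y ⊕ z) ≡ x → y ≡ z
absorbed⇒equal x y z eq = inverseˡ-unique y z (identityʳ-unique x (y ⊕ z) eq)

Σ-three : ∀ a b c → Σ (a ∷ b ∷ c ∷ []) ≡ a ⊕ (b ⊕ c)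
Σ-three a b c = cong (λ u → a ⊕ (b ⊕ u)) (identityʳ c)

Σ-three-distinct : ∀ {a b c} → Unique (a ∷ b ∷ c ∷ []) → Σ (a ∷ b ∷ c ∷ []) ∉ a ∷ b ∷ c ∷ []
Σ-three-distinct {a} {b} {c} ((_ ∷ _ ∷ []) ∷ (b≢c ∷ []) ∷ [] ∷ []) (here t≡a) =
  b≢c (absorbed⇒equal a b c (trans (sym (Σ-three a b c)) t≡a))
Σ-three-distinct {a} {b} {c} ((_ ∷ a≢c ∷ []) ∷ _ ∷ [] ∷ []) (there (here t≡b)) =
  a≢c (absorbed⇒equal b a c (trans (x∙yz≈y∙xz b a c) (trans (sym (Σ-three a b c)) t≡b)))
Σ-three-distinct {a} {b} {c} ((a≢b ∷ _ ∷ []) ∷ _ ∷ [] ∷ []) (there (there (here t≡c))) =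
  a≢b (absorbed⇒equal c a b (trans (comm c (a ⊕ b)) (trans (assoc a b c) (trans (sym (Σ-three a b c)) t≡c))))

-- Whenever the elements of C₂³ are split into a list xs of five and a
-- duplicate-free rest ys, the sum of xs is one of the xs: it equals the
-- sum of the three elements of ys, which is not in ys.
Σ-five-∈ : ∀ xs ys → elements ↭ xs ++ ys → Unique ys → length xs ≡ 5 → Σ xs ∈ xs
Σ-five-∈ xs ys split ys-unique ∣xs∣≡5 = sum-in-first ys ∣ys∣≡3 ys-unique split
  where
    ∣ys∣≡3 : length ys ≡ 3
    ∣ys∣≡3 = +-cancelˡ-≡ 5 _ _ (sym (begin
      8                          ≡⟨ ↭-length split ⟩
      length (xs ++ ys)          ≡⟨ length-++ xs ⟩
      length xs + length ys      ≡⟨ cong (_+ length ys) ∣xs∣≡5 ⟩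
      5 + length ys              ∎))
      where open ≡-Reasoning

    sum-in-first : ∀ ys → length ys ≡ 3 → Unique ys → elements ↭ xs ++ ys → Σ xs ∈ xs
    sum-in-first (a ∷ b ∷ c ∷ []) _ abc-unique split with ∈-++⁻ xs (∈-resp-↭ split (elements-complete (Σ xs)))
    ... | inj₁ ∈xs   = ∈xs
    ... | inj₂ ∈abc = ⊥-elim (Σ-three-distinct abc-unique (subst (_∈ a ∷ b ∷ c ∷ []) Σxs≡Σabc ∈abc))
      where
        Σxs≡Σabc : Σ xs ≡ Σ (a ∷ b ∷ c ∷ [])
        Σxs≡Σabc = inverseˡ-unique (Σ xs) _ (trans (sym (Σ-++ xs _)) (trans (sym (Σ-↭ split)) Σ-elements))

∉-terms? : (S : Vec C₂³ n) → Decidable (_∉ terms S)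
∉-terms? S x = ¬? (x ∈ₗ? terms S)

missing : Vec C₂³ n → List C₂³
missing S = filter (∉-terms? S) elements

missing-unique : (S : Vec C₂³ n) → Unique (missing S)
missing-unique S = Unique.filter⁺ (∉-terms? S) elements-unique

terms-unique : (S : Vec C₂³ n) → Squarefree S → Unique (terms S)
terms-unique S sq = Unique.tabulate⁺ λ {i} {j} → sq i j

elements↭terms++missing : (S : Vec C₂³ n) → Squarefree S → elements ↭ terms S ++ missing S
elements↭terms++missing S sq = ∼bag⇒↭ (unique∧set⇒bag elements-unique
  (Unique.++⁺ (terms-unique S sq) (missing-unique S) disjoint)
  (mk⇔ (λ _ → term-or-missing _) (λ _ → elements-complete _)))
  where
    disjoint : Disjoint (terms S) (missing S)
    disjoint (∈terms , ∈missing) = proj₂ (∈-filter⁻ (∉-terms? S) ∈missing) ∈terms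

    term-or-missing : ∀ x → x ∈ terms S ++ missing S
    term-or-missing x with x ∈ₗ? terms S
    ... | yes ∈terms = ∈-++⁺ˡ ∈terms
    ... | no  ∉terms = ∈-++⁺ʳ (terms S) (∈-filter⁺ (∉-terms? S) (elements-complete x) ∉terms)

σ-is-a-term : (S : Vec C₂³ 5) → Squarefree S → ∃ λ i → lookup S i ≡ σ S ⊤
σ-is-a-term S sq =
  let i , Σ≡gᵢ = ∈-tabulate⁻ {f = lookup S} (Σ-five-∈ (terms S) (missing S) (elements↭terms++missing S sq)
                                (missing-unique S) (length-tabulate (lookup S)))
  in i , trans (sym Σ≡gᵢ) (sym (σ-⊤ S))

-- If gᵢ = σ(S), every zero-sum subsequence of length n of a squarefree
-- sequence of length n + 1 omits exactly gᵢ: the omitted term gⱼ also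
-- equals σ(S), so j = i.
zero-sum-omits : (S : Vec C₂³ (suc n)) → Squarefree S → (i : Fin (suc n)) → lookup S i ≡ σ S ⊤ →
  (T : Subset (suc n)) → ∣ T ∣ ≡ n → σ S T ≡ 𝟘 → T ≡ ∁ ⁅ i ⁆
zero-sum-omits S sq i gᵢ≡σ T ∣T∣≡n zero-sum with ∣p∣≡n⇒p≡∁⁅i⁆ T ∣T∣≡n
... | j , refl = cong (∁ ∘ ⁅_⁆) (sq j i (trans (Equivalence.to (σ-drop-zero⇔ S j) zero-sum) (sym gᵢ≡σ)))

lemma3p4 : (S : Vec C₂³ 5) → Squarefree S →
    ∃ λ (T : Subset 5) → (∣ T ∣ ≡ 4 × σ S T ≡ 𝟘) ×
    ((T′ : Subset 5) → ∣ T′ ∣ ≡ 4 → σ S T′ ≡ 𝟘 → T′ ≡ T)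
lemma3p4 S sq with σ-is-a-term S sq
... | i , gᵢ≡σ =
  ∁ ⁅ i ⁆ , (∣∁⁅i⁆∣ i , Equivalence.from (σ-drop-zero⇔ S i) gᵢ≡σ) , zero-sum-omits S sq i gᵢ≡σ
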